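{- Let $\Sigma=\{a,b\}$. The $\omega$-language $\mathcal{L}(\varphi)$ defined by the $\mathrm{TEL}_{\mathbb{N}^+}$ formula $\varphi=\forall x\,\big(a_x\to((\Box_x b)_{x+1}\wedge a_{2x+1})\big)$ is not $\omega$-regular.
   Context: $\mathrm{TEL}_{\mathbb{N}^+}$ over $\Sigma$: time terms $u,v::=i\mid x\mid u+v$ ($i\in\mathbb{N}^+$, $x$ a time variable); formulas $\varphi::=c\mid\varphi_t\mid\neg\varphi\mid\varphi\wedge\psi\mid\varphi\vee\psi\mid\Box_t\varphi\mid\Diamond_t\varphi\mid\forall x\varphi\mid\exists x\varphi$ ($c\in\Sigma$), $\varphi\to\psi$ abbreviating $\neg\varphi\vee\psi$. For $\alpha=\sigma[1]\sigma[2]\cdots\in\Sigma^\omega$, $i\ge1$: $(\alpha,i)\models c$ iff $\sigma[i]=c$; $(\alpha,i)\models\varphi_t$ iff $(\alpha,i+t)\models\varphi$; Boolean as usual; $(\alpha,i)\models\Box_t\varphi$ iff $(\alpha,j)\models\varphi$ for all $i\le j<i+t$; $\Diamond_t$ dually with "some"; $(\alpha,i)\models\forall x\varphi$ iff $(\alpha,i)\models\varphi[x:=k]$ for all $k\ge1$; $\exists$ dually. $\mathcal{L}(\varphi)=\{\alpha\in\Sigma^\omega\mid(\alpha,1)\models\varphi\}$. A language $L\subseteq\Sigma^\omega$ is $\omega$-regular if it is the set of $\omega$-words accepted by some (nondeterministic) Büchi automaton, i.e. words having a run visiting accepting states infinitely often. -}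

module Defs where

open import Data.Nat using (ℕ; zero; suc; _+_; _≤_; _<_; NonZero)
open import Data.Nat.Properties using (_≟_)
open import Data.Fin using (Fin)
open import Data.Bool using (Bool; T)
open import Data.Product using (Σ; _×_; ∃; ∃-syntax; _,_)
open import Data.Sum using (_⊎_)
open import Data.Empty using (⊥)
open import Relation.Nullary using (¬_; yes; no)
open import Relation.Binary.PropositionalEquality using (_≡_)
open import Function.Bundles using (_⇔_)

data Letter : Set where
  a b : Letter

-- ω-words over Σ.  Position i of the paper (i ≥ 1) is index (i - 1) here.
Word : Set
Word = ℕ → Letter

Var : Set
Var = ℕ

data TTerm : Set where
  lit  : (i : ℕ) → .{{NonZero i}} → TTerm
  var  : Var → TTerm
  _⊕_  : TTerm → TTerm → TTerm

data Formula : Set where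
  letter : Letter → Formula
  shift  : Formula → TTerm → Formula
  neg    : Formula → Formula
  _∧'_   : Formula → Formula → Formula
  _∨'_   : Formula → Formula → Formula
  box    : TTerm → Formula → Formula
  dia    : TTerm → Formula → Formula
  all'   : Var → Formula → Formula
  ex'    : Var → Formula → Formula

_⇒'_ : Formula → Formula → Formula
φ ⇒' ψ = neg φ ∨' ψ

-- Valuations of time variables (only values ≥ 1 are ever assigned by quantifiers).
Env : Set
Env = Var → ℕ

update : Env → Var → ℕ → Env
update ρ x k y with y ≟ x
... | yes _ = k
... | no  _ = ρ y

⟦_⟧ : TTerm → Env → ℕ
⟦ lit i ⟧ ρ = i
⟦ var x ⟧ ρ = ρ x
⟦ u ⊕ v ⟧ ρ = ⟦ u ⟧ ρ + ⟦ v ⟧ ρ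

-- Satisfaction (α, i) ⊨ φ, under valuation ρ (substitution of values for
-- variables, as in the paper, is represented by the valuation).
Sat : Word → ℕ → Env → Formula → Set
Sat α i ρ (letter c) = α i ≡ c
Sat α i ρ (shift φ t) = Sat α (i + ⟦ t ⟧ ρ) ρ φ
Sat α i ρ (neg φ) = ¬ Sat α i ρ φ
Sat α i ρ (φ ∧' ψ) = Sat α i ρ φ × Sat α i ρ ψ
Sat α i ρ (φ ∨' ψ) = Sat α i ρ φ ⊎ Sat α i ρ ψ
Sat α i ρ (box t φ) = (j : ℕ) → i ≤ j → j < i + ⟦ t ⟧ ρ → Sat α j ρ φ
Sat α i ρ (dia t φ) = ∃[ j ] (i ≤ j × j < i + ⟦ t ⟧ ρ × Sat α j ρ φ)
Sat α i ρ (all' x φ) = (k : ℕ) → Sat α i (update ρ x (suc k)) φ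
Sat α i ρ (ex' x φ) = ∃[ k ] Sat α i (update ρ x (suc k)) φ

-- Default valuation (irrelevant for closed formulas)
ρ₀ : Env
ρ₀ _ = 1

-- 𝓛(φ) = { α | (α,1) ⊨ φ }   (paper position 1 = index 0)
𝓛 : Formula → Word → Set
𝓛 φ α = Sat α 0 ρ₀ φ

record Buchi : Set where
  field
    n     : ℕ
    init  : Fin n → Bool
    δ     : Fin n → Letter → Fin n → Bool
    acc   : Fin n → Bool

Accepts : Buchi → Word → Set
Accepts A α = Σ (ℕ → Fin n) λ r → (T (init (r 0))
                     × ((i : ℕ) → T (δ (r i) (α i) (r (suc i))))
                     × ((m : ℕ) → ∃[ k ] (m ≤ k × T (acc (r k)))))
  where open Buchi A

OmegaRegular : (Word → Set) → Set
OmegaRegular L = ∃[ A ] ((α : Word) → L α ⇔ Accepts A α)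

-- φ = ∀x ( a_x → ((□_x b)_{x+1} ∧ a_{2x+1}) ),  x the variable 0, 2x written x + x
φ₁₀ : Formula
φ₁₀ = all' 0 (shift (letter a) (var 0)
        ⇒' (shift (box (var 0) (letter b)) (var 0 ⊕ lit 1)
            ∧' shift (letter a) ((var 0 ⊕ var 0) ⊕ lit 1)))

-- A Büchi automaton accepting the word with a's exactly at x, 2x+1, 4x+3, … (x larger than its
-- number of states) repeats a state while reading the initial block b^x.  Cutting out that loop
-- of length d gives an accepted word whose first a is at k = x − d, but whose position 2k+1 carries
-- the letter of the original word at 2x+1−d, a b strictly between x and 2x+1; so φ fails there.
module Submission where

open import Defs

open import Data.Bool using (T)
open import Data.Fin using (Fin; toℕ; fromℕ<)
open import Data.Fin.Properties using (any?; pigeonhole; toℕ≤pred[n]; toℕ-fromℕ<)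
open import Data.Nat using (ℕ; zero; suc; _+_; _∸_; _≤_; _<_; _≤′_; ≤′-reflexive; ≤′-step; z≤n; s≤s; z<s; _≤?_)
open import Data.Nat.GeneralisedArithmetic using (fold)
open import Data.Nat.Properties
open import Data.Nat.Tactic.RingSolver using (solve-∀)
open import Data.Product using (∃; ∃₂; ∃-syntax; _×_; _,_; proj₁; proj₂)
open import Data.Sum using (inj₁; inj₂)
open import Function using (_∘_; _⇔_; mk⇔; Equivalence)
open import Relation.Binary.PropositionalEquality using (_≡_; refl; sym; trans; cong; subst)
open import Relation.Nullary using (¬_; Dec; yes; no; contradiction)
import Relation.Nullary.Decidable as Dec

next : ℕ → ℕ
next k = suc (k + k)

orbit : ℕ → ℕ → ℕ
orbit x = fold x next

InOrbit : ℕ → ℕ → Set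
InOrbit x k = ∃[ m ] orbit x m ≡ k

m≤orbit : ∀ x m → m ≤ orbit x m
m≤orbit x zero    = z≤n
m≤orbit x (suc m) = s≤s (≤-trans (m≤orbit x m) (m≤m+n _ _))

orbit-mono : ∀ x {m m′} → m ≤′ m′ → orbit x m ≤ orbit x m′
orbit-mono x (≤′-reflexive refl) = ≤-refl
orbit-mono x (≤′-step m≤′m′)     = ≤-trans (orbit-mono x m≤′m′) (m≤n⇒m≤1+n (m≤m+n _ _))

orbit-gap : ∀ x m {z} → orbit x m < z → z < next (orbit x m) → ¬ InOrbit x z
orbit-gap x m below above (m′ , refl) with m′ ≤? m
... | yes m′≤m = <⇒≱ below (orbit-mono x (≤⇒≤′ m′≤m))
... | no  m′≰m = <⇒≱ above (orbit-mono x (≤⇒≤′ (≰⇒> m′≰m)))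

inOrbit? : ∀ x k → Dec (InOrbit x k)
inOrbit? x k = Dec.map′ (λ (m , eq) → toℕ m , eq) bounded (any? (λ m → orbit x (toℕ m) ≟ k))
  where
  bounded : InOrbit x k → ∃ λ (m : Fin (suc k)) → orbit x (toℕ m) ≡ k
  bounded (m , refl) = fromℕ< m<1+k , cong (orbit x) (toℕ-fromℕ< m<1+k)
    where
    m<1+k : m < suc (orbit x m)
    m<1+k = s≤s (m≤orbit x m)

doublingWord : ℕ → Word
doublingWord x k with inOrbit? x k
... | yes _ = a
... | no  _ = b

module _ {x k : ℕ} where

  doublingWord-a : InOrbit x k → doublingWord x k ≡ a
  doublingWord-a k∈ with inOrbit? x k
  ... | yes _  = refl
  ... | no  k∉ = contradiction k∈ k∉

  doublingWord-b : ¬ InOrbit x k → doublingWord x k ≡ b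
  doublingWord-b k∉ with inOrbit? x k
  ... | yes k∈ = contradiction k∈ k∉
  ... | no  _  = refl

  doublingWord-a⁻¹ : doublingWord x k ≡ a → InOrbit x k
  doublingWord-a⁻¹ eq with inOrbit? x k
  doublingWord-a⁻¹ eq | yes k∈ = k∈
  doublingWord-a⁻¹ () | no  _

-- Index k ≥ 1 is the paper's position k + 1 ≥ 2; index 0 is never constrained by φ₁₀.
DoublingClosed : Word → Set
DoublingClosed β = ∀ k → 0 < k → β k ≡ a →
  (∀ j → k < j → j < next k → β j ≡ b) × β (next k) ≡ a

doublingWord-closed : ∀ x → DoublingClosed (doublingWord x)
doublingWord-closed x k _ βk≡a with doublingWord-a⁻¹ βk≡a
... | m , refl = (λ j k<j j<next → doublingWord-b (orbit-gap x m k<j j<next))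
               , doublingWord-a (suc m , refl)

𝓛φ₁₀⇔DoublingClosed : ∀ β → 𝓛 φ₁₀ β ⇔ DoublingClosed β
𝓛φ₁₀⇔DoublingClosed β = mk⇔ sound complete
  where
  k+1≡1+k : ∀ k → k + 1 ≡ suc k
  k+1≡1+k k = +-comm k 1

  sound : 𝓛 φ₁₀ β → DoublingClosed β
  sound sat (suc k) _ βk≡a with sat k
  ... | inj₁ βk≢a = contradiction βk≡a βk≢a
  ... | inj₂ (between , after) =
        (λ j k<j j<next → between j (subst (λ t → suc t ≤ j) (sym (k+1≡1+k k)) k<j)
                                    (subst (λ t → j < suc (t + suc k)) (sym (k+1≡1+k k)) j<next))
      , subst (λ t → β t ≡ a) (k+1≡1+k _) after

  complete : DoublingClosed β → 𝓛 φ₁₀ β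
  complete closed k with β (suc k) in βk
  ... | b = inj₁ λ ()
  ... | a with closed (suc k) z<s βk
  ... | between , after = inj₂
        ( (λ j k<j j<next → between j (subst (λ t → suc t ≤ j) (k+1≡1+k k) k<j)
                                      (subst (λ t → j < suc (t + suc k)) (k+1≡1+k k) j<next))
        , subst (λ t → β t ≡ a) (sym (k+1≡1+k _)) after )

-- skip p d renumbers the positions of a word so that the block [p, p + d) is cut out.
skip : ℕ → ℕ → ℕ → ℕ
skip zero    d k       = k + d
skip (suc p) d zero    = zero
skip (suc p) d (suc k) = suc (skip p d k)

skip-≥ : ∀ {p d k} → p ≤ k → skip p d k ≡ k + d
skip-≥ z≤n       = refl
skip-≥ (s≤s p≤k) = cong suc (skip-≥ p≤k)

module _ {A : Set} where

  skip-zero : ∀ {p d} (f : ℕ → A) → f p ≡ f (p + d) → f (skip p d 0) ≡ f 0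
  skip-zero {zero}  f loop = sym loop
  skip-zero {suc p} f loop = refl

  skip-suc : ∀ {p d} (f : ℕ → A) → f p ≡ f (p + d) → ∀ k → f (skip p d (suc k)) ≡ f (suc (skip p d k))
  skip-suc {zero}  f loop k       = refl
  skip-suc {suc p} f loop zero    = skip-zero (f ∘ suc) loop
  skip-suc {suc p} f loop (suc k) = skip-suc (f ∘ suc) loop k

InfinitelyOften : (ℕ → Set) → Set
InfinitelyOften P = ∀ m → ∃[ k ] (m ≤ k × P k)

infinitelyOften-skip : ∀ {P} p d → InfinitelyOften P → InfinitelyOften (P ∘ skip p d)
infinitelyOften-skip {P} p d often m with often (p + m + d)
... | k , p+m+d≤k , Pk with m≤n⇒∃[o]m+o≡n p+m+d≤k
... | t , refl = p + m + t , ≤-trans (m≤n+m m p) (m≤m+n _ t) , subst P (sym skip≡) Pk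
  where
  skip≡ : skip p d (p + m + t) ≡ p + m + d + t
  skip≡ = trans (skip-≥ (≤-trans (m≤m+n p m) (m≤m+n _ t))) (+-assoc-comm (p + m) t d)
    where
    +-assoc-comm : ∀ u t d → u + t + d ≡ u + d + t
    +-assoc-comm = solve-∀

accepts-skip : ∀ A {α} p d (run : Accepts A α) → proj₁ run p ≡ proj₁ run (p + d) →
               Accepts A (α ∘ skip p d)
accepts-skip A p d (r , initial , step , accepting) loop =
    r ∘ skip p d
  , subst (T ∘ init) (sym (skip-zero r loop)) initial
  , (λ k → subst (T ∘ δ _ _) (sym (skip-suc r loop k)) (step (skip p d k)))
  , infinitelyOften-skip p d accepting
  where open Buchi A

repeats : ∀ {n} (f : ℕ → Fin n) → ∃₂ λ p d → 0 < d × p + d ≤ n × f p ≡ f (p + d)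
repeats {n} f with pigeonhole (n<1+n n) (f ∘ toℕ)
... | i , j , i<j , fi≡fj with m≤n⇒∃[o]m+o≡n i<j
... | o , i+1+o≡j = toℕ i , suc o , z<s
                  , subst (_≤ n) (sym i+d≡j) (toℕ≤pred[n] j)
                  , trans fi≡fj (cong f (sym i+d≡j))
  where
  i+d≡j : toℕ i + suc o ≡ toℕ j
  i+d≡j = trans (+-suc (toℕ i) o) i+1+o≡j

deletion-breaks-closure : ∀ {x p d} → p + d < x → 0 < d → ¬ DoublingClosed (doublingWord x ∘ skip p d)
deletion-breaks-closure {x} {p} {d} p+d<x 0<d closed =
  contradiction (trans (sym after-gap-is-b) after-is-a) λ ()
  where
  k = x ∸ d
  d≤x : d ≤ x
  d≤x = ≤-trans (m≤n+m d p) (<⇒≤ p+d<x)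
  k+d≡x : k + d ≡ x
  k+d≡x = m∸n+n≡m d≤x
  p≤k : p ≤ k
  p≤k = m+n≤o⇒m≤o∸n p (<⇒≤ p+d<x)
  first-a : doublingWord x (skip p d k) ≡ a
  first-a = trans (cong (doublingWord x) (trans (skip-≥ p≤k) k+d≡x)) (doublingWord-a (0 , refl))
  after-is-a : doublingWord x (skip p d (next k)) ≡ a
  after-is-a = proj₂ (closed k (m<n⇒0<n∸m (≤-<-trans (m≤n+m d p) p+d<x)) first-a)
  k<next : k < next k
  k<next = s≤s (m≤m+n k k)
  x<next-k+d : x < next k + d
  x<next-k+d = subst (_< next k + d) k+d≡x (+-monoˡ-< d k<next)
  next-k+d<next-x : next k + d < next x
  next-k+d<next-x = subst (λ y → next k + d < next y) k+d≡x
                      (s≤s (subst (k + k + d <_) (double-sum k d) (m<m+n _ 0<d)))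
    where
    double-sum : ∀ k d → k + k + d + d ≡ k + d + (k + d)
    double-sum = solve-∀
  after-gap-is-b : doublingWord x (skip p d (next k)) ≡ b
  after-gap-is-b = trans (cong (doublingWord x) (skip-≥ (≤-trans p≤k (<⇒≤ k<next))))
                         (doublingWord-b (orbit-gap x 0 x<next-k+d next-k+d<next-x))

mainTheorem10 : ¬ OmegaRegular (𝓛 φ₁₀)
mainTheorem10 (A , L⇔Accepts) =
  let x   = suc (Buchi.n A)
      run = Equivalence.to (L⇔Accepts (doublingWord x))
              (Equivalence.from (𝓛φ₁₀⇔DoublingClosed _) (doublingWord-closed x))
      (p , d , 0<d , p+d≤n , loop) = repeats (proj₁ run)
      cut = accepts-skip A p d run loop
  in deletion-breaks-closure (s≤s p+d≤n) 0<d
       (Equivalence.to (𝓛φ₁₀⇔DoublingClosed _) (Equivalence.from (L⇔Accepts _) cut))
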